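{- Let $\mathbf C$ be a category with a functor $|\cdot|:\mathbf C\to\mathbf{Set}$, assume $\mathbf C$ has binary products, let $F:\mathbf C\to\mathbf C$ be a functor and let $\lambda:\Psi\to\Psi F$ be an indexed morphism such that $\lambda_X(\equiv_X)=\,\equiv_{FX}$ for every object $X$. Then for every $F$-coalgebra homomorphism $f:(X,\alpha)\to(Y,\beta)$ (i.e. $f:X\to Y$ with $Ff\circ\alpha=\beta\circ f$) we have $$f^*(\equiv_Y)\subseteq \alpha^*\big(\lambda_X(f^*(\equiv_Y))\big),$$ i.e. the behavioural equivalence induced by $f$ is an $\alpha^*\circ\lambda_X$-coalgebra in the poset $\Psi X$.
   Context: Binary products in $\mathbf C$ are written $X\otimes Y$, with projections $\pi_1^X,\pi_2^X:X\otimes X\to X$; for $g:X\to Y$, $g\otimes g:X\otimes X\to Y\otimes Y$ is the induced morphism. $\Psi X$ is the poset (under $\subseteq$) of subsets of $|X\otimes X|$, and for $g:X\to Y$ the reindexing is $g^*:\Psi Y\to\Psi X$, $g^*(S)=|g\otimes g|^{ -1}(S)$. Abstract equality: $\equiv_X=\langle|\pi_1^X|,|\pi_2^X|\rangle^{ -1}(\{(x,x)\mid x\in|X|\})\in\Psi X$. An indexed morphism $\lambda:\Psi\to\Psi F$ is a family of monotone maps $\lambda_X:\Psi X\to\Psi(FX)$ such that $\lambda_X(g^*S)=(Fg)^*(\lambda_Y S)$ for all $g:X\to Y$ and $S\in\Psi Y$. For a coalgebra $\alpha:X\to FX$, $\alpha^*:\Psi(FX)\to\Psi X$ is reindexing along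 $\alpha$. -}

module Defs where

open import Level using (Level; _⊔_; suc; zero)
open import Data.Product using (_×_; _,_)
open import Relation.Binary.PropositionalEquality using (_≡_)

record Category (o ℓ : Level) : Set (Level.suc (o ⊔ ℓ)) where
  infixr 9 _∘_
  field
    Obj  : Set o
    Hom  : Obj → Obj → Set ℓ
    id   : ∀ {A} → Hom A A
    _∘_  : ∀ {A B C} → Hom B C → Hom A B → Hom A C
    idˡ  : ∀ {A B} (f : Hom A B) → id ∘ f ≡ f
    idʳ  : ∀ {A B} (f : Hom A B) → f ∘ id ≡ f
    assoc : ∀ {A B C D} (h : Hom C D) (g : Hom B C) (f : Hom A B) →
            (h ∘ g) ∘ f ≡ h ∘ (g ∘ f)

record SetFunctor {o ℓ} (C : Category o ℓ) : Set (Level.suc Level.zero ⊔ o ⊔ ℓ) where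
  open Category C
  field
    ob   : Obj → Set
    map  : ∀ {A B} → Hom A B → ob A → ob B
    map-id : ∀ {A} (x : ob A) → map (id {A}) x ≡ x
    map-∘  : ∀ {A B C} (g : Hom B C) (f : Hom A B) (x : ob A) →
             map (g ∘ f) x ≡ map g (map f x)

record Endofunctor {o ℓ} (C : Category o ℓ) : Set (o ⊔ ℓ) where
  open Category C
  field
    F₀ : Obj → Obj
    F₁ : ∀ {A B} → Hom A B → Hom (F₀ A) (F₀ B)
    F-id : ∀ {A} → F₁ (id {A}) ≡ id
    F-∘  : ∀ {A B C} (g : Hom B C) (f : Hom A B) → F₁ (g ∘ f) ≡ F₁ g ∘ F₁ f

record BinaryProducts {o ℓ} (C : Category o ℓ) : Set (o ⊔ ℓ) where
  open Category C
  infixr 7 _⊗_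
  field
    _⊗_ : Obj → Obj → Obj
    π₁  : ∀ {A B} → Hom (A ⊗ B) A
    π₂  : ∀ {A B} → Hom (A ⊗ B) B
    ⟨_,_⟩ : ∀ {A B Z} → Hom Z A → Hom Z B → Hom Z (A ⊗ B)
    π₁-⟨⟩ : ∀ {A B Z} (f : Hom Z A) (g : Hom Z B) → π₁ ∘ ⟨ f , g ⟩ ≡ f
    π₂-⟨⟩ : ∀ {A B Z} (f : Hom Z A) (g : Hom Z B) → π₂ ∘ ⟨ f , g ⟩ ≡ g
    ⟨⟩-unique : ∀ {A B Z} (f : Hom Z A) (g : Hom Z B) (h : Hom Z (A ⊗ B)) →
                π₁ ∘ h ≡ f → π₂ ∘ h ≡ g → h ≡ ⟨ f , g ⟩

module Setting {o ℓ} (C : Category o ℓ) (U : SetFunctor C) (P : BinaryProducts C) where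
  open Category C
  open SetFunctor U renaming (ob to ∣_∣; map to ∣_∣₁)
  open BinaryProducts P

  _⊗₁_ : ∀ {X Y} → Hom X Y → Hom X Y → Hom (X ⊗ X) (Y ⊗ Y)
  g ⊗₁ h = ⟨ g ∘ π₁ , h ∘ π₂ ⟩

  Ψ : Obj → Set₁
  Ψ X = ∣ X ⊗ X ∣ → Set

  _⊆_ : ∀ {X} → Ψ X → Ψ X → Set
  S ⊆ T = ∀ z → S z → T z

  _≐_ : ∀ {X} → Ψ X → Ψ X → Set
  S ≐ T = (S ⊆ T) × (T ⊆ S)

  _* : ∀ {X Y} → Hom X Y → Ψ Y → Ψ X
  (g *) S z = S (∣ g ⊗₁ g ∣₁ z)

  Eq : (X : Obj) → Ψ X
  Eq X z = ∣ π₁ {X} {X} ∣₁ z ≡ ∣ π₂ {X} {X} ∣₁ z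

  record IndexedMorphism (F : Endofunctor C) : Set (Level.suc Level.zero ⊔ o ⊔ ℓ) where
    open Endofunctor F
    field
      λ₀ : ∀ X → Ψ X → Ψ (F₀ X)
      monotone : ∀ X {S T : Ψ X} → S ⊆ T → λ₀ X S ⊆ λ₀ X T
      natural : ∀ {X Y} (g : Hom X Y) (S : Ψ Y) →
                λ₀ X ((g *) S) ≐ ((F₁ g) *) (λ₀ Y S)

{-# OPTIONS --safe #-}
-- Two elements identified by f stay identified by β ∘ f = F f ∘ α, so f*(≡_Y) lies in
-- α*((F f)*(≡_{FY})). Since λ preserves abstract equality and commutes with reindexing,
-- (F f)*(≡_{FY}) = (F f)*(λ_Y ≡_Y) = λ_X (f*(≡_Y)).
module Submission where

open import Defs
open import Relation.Binary.PropositionalEquality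
  using (_≡_; refl; sym; trans; cong; module ≡-Reasoning)
open import Data.Product using (proj₂)

module Reindexing {o ℓ} (C : Category o ℓ) (U : SetFunctor C) (P : BinaryProducts C) where
  open Category C
  open SetFunctor U renaming (ob to ∣_∣; map to ∣_∣₁)
  open BinaryProducts P
  open Setting C U P
  open ≡-Reasoning

  ∣∣-cong : ∀ {A B} {g h : Hom A B} → g ≡ h → ∀ x → ∣ g ∣₁ x ≡ ∣ h ∣₁ x
  ∣∣-cong refl x = refl

  ∣π₁∣-⊗₁ : ∀ {A B} (g : Hom A B) w → ∣ π₁ ∣₁ (∣ g ⊗₁ g ∣₁ w) ≡ ∣ g ∣₁ (∣ π₁ ∣₁ w)
  ∣π₁∣-⊗₁ g w = begin
    ∣ π₁ ∣₁ (∣ g ⊗₁ g ∣₁ w) ≡⟨ sym (map-∘ π₁ (g ⊗₁ g) w) ⟩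
    ∣ π₁ ∘ (g ⊗₁ g) ∣₁ w     ≡⟨ ∣∣-cong (π₁-⟨⟩ (g ∘ π₁) (g ∘ π₂)) w ⟩
    ∣ g ∘ π₁ ∣₁ w            ≡⟨ map-∘ g π₁ w ⟩
    ∣ g ∣₁ (∣ π₁ ∣₁ w)       ∎

  ∣π₂∣-⊗₁ : ∀ {A B} (g : Hom A B) w → ∣ π₂ ∣₁ (∣ g ⊗₁ g ∣₁ w) ≡ ∣ g ∣₁ (∣ π₂ ∣₁ w)
  ∣π₂∣-⊗₁ g w = begin
    ∣ π₂ ∣₁ (∣ g ⊗₁ g ∣₁ w) ≡⟨ sym (map-∘ π₂ (g ⊗₁ g) w) ⟩
    ∣ π₂ ∘ (g ⊗₁ g) ∣₁ w     ≡⟨ ∣∣-cong (π₂-⟨⟩ (g ∘ π₁) (g ∘ π₂)) w ⟩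
    ∣ g ∘ π₂ ∣₁ w            ≡⟨ map-∘ g π₂ w ⟩
    ∣ g ∣₁ (∣ π₂ ∣₁ w)       ∎

  kernel⇒equalised : ∀ {A B} (g : Hom A B) w →
               (g *) (Eq B) w → ∣ g ∣₁ (∣ π₁ ∣₁ w) ≡ ∣ g ∣₁ (∣ π₂ ∣₁ w)
  kernel⇒equalised g w e = trans (sym (∣π₁∣-⊗₁ g w)) (trans e (∣π₂∣-⊗₁ g w))

  equalised⇒kernel : ∀ {A B} (g : Hom A B) w →
                  ∣ g ∣₁ (∣ π₁ ∣₁ w) ≡ ∣ g ∣₁ (∣ π₂ ∣₁ w) → (g *) (Eq B) w
  equalised⇒kernel g w e = trans (∣π₁∣-⊗₁ g w) (trans e (sym (∣π₂∣-⊗₁ g w)))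

  kernel-∘-⊆ : ∀ {A B D} (h : Hom B D) (g : Hom A B) → (g *) (Eq B) ⊆ ((h ∘ g) *) (Eq D)
  kernel-∘-⊆ h g w e = equalised⇒kernel (h ∘ g) w (begin
    ∣ h ∘ g ∣₁ (∣ π₁ ∣₁ w)    ≡⟨ map-∘ h g _ ⟩
    ∣ h ∣₁ (∣ g ∣₁ (∣ π₁ ∣₁ w)) ≡⟨ cong ∣ h ∣₁ (kernel⇒equalised g w e) ⟩
    ∣ h ∣₁ (∣ g ∣₁ (∣ π₂ ∣₁ w)) ≡⟨ sym (map-∘ h g _) ⟩
    ∣ h ∘ g ∣₁ (∣ π₂ ∣₁ w)    ∎)

  kernel-∘-reindex : ∀ {A B D} (h : Hom B D) (g : Hom A B) →
                     ((h ∘ g) *) (Eq D) ⊆ (g *) ((h *) (Eq D))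
  kernel-∘-reindex h g w e = equalised⇒kernel h (∣ g ⊗₁ g ∣₁ w) (begin
    ∣ h ∣₁ (∣ π₁ ∣₁ (∣ g ⊗₁ g ∣₁ w)) ≡⟨ cong ∣ h ∣₁ (∣π₁∣-⊗₁ g w) ⟩
    ∣ h ∣₁ (∣ g ∣₁ (∣ π₁ ∣₁ w))      ≡⟨ sym (map-∘ h g _) ⟩
    ∣ h ∘ g ∣₁ (∣ π₁ ∣₁ w)          ≡⟨ kernel⇒equalised (h ∘ g) w e ⟩
    ∣ h ∘ g ∣₁ (∣ π₂ ∣₁ w)          ≡⟨ map-∘ h g _ ⟩
    ∣ h ∣₁ (∣ g ∣₁ (∣ π₂ ∣₁ w))      ≡⟨ cong ∣ h ∣₁ (sym (∣π₂∣-⊗₁ g w)) ⟩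
    ∣ h ∣₁ (∣ π₂ ∣₁ (∣ g ⊗₁ g ∣₁ w)) ∎)

  kernel-cong : ∀ {A B} {g h : Hom A B} → g ≡ h → (g *) (Eq B) ⊆ (h *) (Eq B)
  kernel-cong refl w e = e

theorem1 : ∀ {o ℓ} (C : Category o ℓ) (U : SetFunctor C) (P : BinaryProducts C)
    (F : Endofunctor C) (L : Setting.IndexedMorphism C U P F) →
    (∀ X → Setting._≐_ C U P (Setting.IndexedMorphism.λ₀ L X (Setting.Eq C U P X))
    (Setting.Eq C U P (Endofunctor.F₀ F X))) →
    ∀ {X Y} (α : Category.Hom C X (Endofunctor.F₀ F X))
    (β : Category.Hom C Y (Endofunctor.F₀ F Y)) (f : Category.Hom C X Y) →
    Category._∘_ C (Endofunctor.F₁ F f) α ≡ Category._∘_ C β f →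
    Setting._⊆_ C U P (Setting._* C U P f (Setting.Eq C U P Y))
    (Setting._* C U P α
    (Setting.IndexedMorphism.λ₀ L X (Setting._* C U P f (Setting.Eq C U P Y))))
theorem1 C U P F L λ-Eq {X} {Y} α β f comm w w∈kernel-f =
  proj₂ (natural f (Eq Y)) _ (proj₂ (λ-Eq Y) _ αw∈kernel-Ff)
  where
  open Category C
  open Endofunctor F
  open Setting C U P
  open IndexedMorphism L
  open Reindexing C U P

  αw∈kernel-Ff : (α *) ((F₁ f *) (Eq (F₀ Y))) w
  αw∈kernel-Ff = kernel-∘-reindex (F₁ f) α w
                 (kernel-cong (sym comm) w (kernel-∘-⊆ β f w w∈kernel-f))
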